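{- Fix an integer $p \geq 2$. For a positive integer $n$ and an integer $k \geq 0$, let $A_k(n)$ be the set of partitions of $n$ in which exactly $k$ distinct part sizes are divisible by $2^{p}$ (each such part size possibly repeated), and let $B_k(n)$ be the set of partitions of $n$ in which exactly $k$ distinct part sizes appear at least $2^{p}$ times. Then there is a bijection between $A_k(n)$ and $B_k(n)$; in particular $|A_k(n)| = |B_k(n)|$.
   Context: A partition of $n$ is a multiset of positive integers (parts) summing to $n$. A part size $m$ is "divisible by an exponent of $2$ that is at least $p$" exactly when $2^{p} \mid m$. The number of times a part size appears in a partition is its multiplicity. -}

module Defs where

open import Data.Nat using (ℕ; _^_; _≤_; _≥_; _≟_; _≤?_)
open import Data.Nat.Divisibility using (_∣_; _∣?_)
open import Data.Nat.ListAction using (sum)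
open import Data.List using (List; length; filter; deduplicate)
open import Data.List.Relation.Unary.All using (All)
open import Data.List.Relation.Unary.Linked using (Linked)
open import Data.Product using (Σ; _×_; proj₁)
open import Relation.Binary.PropositionalEquality using (_≡_)

-- A partition of n: canonical representation as a weakly decreasing list
-- of positive parts summing to n (so partitions = multisets of parts).
IsPartition : ℕ → List ℕ → Set
IsPartition n ps = All (λ x → 1 ≤ x) ps × Linked _≥_ ps × sum ps ≡ n

Partition : ℕ → Set
Partition n = Σ (List ℕ) (IsPartition n)

partSizes : List ℕ → List ℕ
partSizes ps = deduplicate _≟_ ps

multiplicity : ℕ → List ℕ → ℕ
multiplicity m ps = length (filter (m ≟_) ps)

numDivSizes : ℕ → List ℕ → ℕ
numDivSizes p ps = length (filter (λ m → (2 ^ p) ∣? m) (partSizes ps))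

numFreqSizes : ℕ → List ℕ → ℕ
numFreqSizes p ps =
  length (filter (λ m → (2 ^ p) ≤? multiplicity m ps) (partSizes ps))

A : ℕ → ℕ → ℕ → Set
A p n k = Σ (Partition n) (λ π → numDivSizes p (proj₁ π) ≡ k)

B : ℕ → ℕ → ℕ → Set
B p n k = Σ (Partition n) (λ π → numFreqSizes p (proj₁ π) ≡ k)

-- Write M = 2 ^ p and encode a partition of N by its multiplicity function f. Every size
-- factors uniquely as d = M ^ j * d₀ with M ∤ d₀, and the bijection sends f to
--   g d = M * f (M * d) + (the j-th base-M digit of f d₀):
-- each copy of M * d is broken into M copies of d, and the multiplicity of d₀ is spread over
-- the chain d₀, M * d₀, M ^ 2 * d₀, … according to its base-M digits. This preserves the weight
-- Σ d * f d, and as the digit is < M, g d ≥ M exactly when f (M * d) > 0: the sizes occurring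
-- at least M times in g correspond to the sizes divisible by M in f. The inverse reads off
-- f (M * d) = g d / M and reassembles f d₀ from the digits g (M ^ j * d₀) % M.
module Submission where

open import Defs
open import Algebra.Properties.CommutativeSemigroup using (interchange)
open import Data.Nat
  using (ℕ; zero; suc; pred; _+_; _*_; _^_; _≤_; _<_; _≥_; z≤n; s≤s; z<s; _≟_; _≤?_; NonZero; >-nonZero)
open import Data.Nat.Properties
open import Data.Nat.Divisibility using (_∣_; _∣?_; ∣⇒≤; ∣m+n∣m⇒∣n; m∣m*n)
open import Data.Nat.DivMod
open import Data.Nat.ListAction using (sum)
open import Data.Nat.ListAction.Properties using (sum-++)
open import Data.Nat.Solver using (module +-*-Solver)
open import Data.List using (List; []; _∷_; _++_; length; filter; replicate)
open import Data.List.Properties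
  using (length-++; filter-++; filter-accept; filter-reject; filter-all; filter-none; filter-idem)
open import Data.List.Relation.Unary.All as All using (All; []; _∷_)
import Data.List.Relation.Unary.All.Properties as All
open import Data.List.Relation.Unary.Linked as Linked using (Linked; []; [-]; _∷_)
import Data.List.Relation.Unary.Linked.Properties as Linked
open import Data.Product using (Σ; _×_; _,_; proj₁; proj₂)
open import Data.Sum using (_⊎_; inj₁; inj₂)
open import Function using (_∘_; flip)
open import Function.Bundles using (_⤖_; mk↔ₛ′)
open import Function.Properties.Inverse using (↔⇒⤖)
open import Relation.Binary.PropositionalEquality
open import Relation.Nullary using (¬_; Dec; yes; no; ¬?; contradiction)
open import Relation.Unary using (Decidable)

sumTo : (ℕ → ℕ) → ℕ → ℕ
sumTo F zero = 0
sumTo F (suc N) = F (suc N) + sumTo F N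

VanishesAbove : ℕ → (ℕ → ℕ) → Set
VanishesAbove N f = ∀ s → N < s → f s ≡ 0

InRange : ℕ → ℕ → Set
InRange N s = 1 ≤ s × s ≤ N

-- Multiplicity functions are compared on positive sizes only: their value at 0 is junk.
_≗⁺_ : (ℕ → ℕ) → (ℕ → ℕ) → Set
f ≗⁺ g = ∀ s → 1 ≤ s → f s ≡ g s

sumTo-cong : ∀ N {F G} → (∀ s → InRange N s → F s ≡ G s) → sumTo F N ≡ sumTo G N
sumTo-cong zero F≗G = refl
sumTo-cong (suc N) F≗G =
  cong₂ _+_ (F≗G (suc N) (s≤s z≤n , ≤-refl))
            (sumTo-cong N (λ s (1≤s , s≤N) → F≗G s (1≤s , m≤n⇒m≤1+n s≤N)))

sumTo-distrib-+ : ∀ N F G → sumTo (λ s → F s + G s) N ≡ sumTo F N + sumTo G N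
sumTo-distrib-+ zero F G = refl
sumTo-distrib-+ (suc N) F G =
  trans (cong (F (suc N) + G (suc N) +_) (sumTo-distrib-+ N F G))
        (interchange +-commutativeSemigroup (F (suc N)) (G (suc N)) _ _)

term≤sumTo : ∀ N F {s} → InRange N s → F s ≤ sumTo F N
term≤sumTo zero F (1≤s , s≤0) = contradiction (≤-trans 1≤s s≤0) λ ()
term≤sumTo (suc N) F {s} (1≤s , s≤1+N) with m≤n⇒m<n∨m≡n s≤1+N
... | inj₁ s<1+N = ≤-trans (term≤sumTo N F (1≤s , ≤-pred s<1+N)) (m≤n+m (sumTo F N) (F (suc N)))
... | inj₂ refl = m≤m+n (F s) (sumTo F N)

sumTo-vanishing : ∀ {N N′ F} → N ≤ N′ → VanishesAbove N F → sumTo F N′ ≡ sumTo F N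
sumTo-vanishing {N′ = zero} z≤n _ = refl
sumTo-vanishing {N′ = suc N′} {F} N≤1+N′ F≡0 with m≤n⇒m<n∨m≡n N≤1+N′
... | inj₁ N<1+N′ = trans (cong (_+ sumTo F N′) (F≡0 (suc N′) N<1+N′)) (sumTo-vanishing (≤-pred N<1+N′) F≡0)
... | inj₂ refl = refl

-- Partitions as multiplicity functions

weight : ℕ → (ℕ → ℕ) → ℕ
weight N f = sumTo (λ s → s * f s) N

mults : List ℕ → ℕ → ℕ
mults ps s = multiplicity s ps

fromMult : ℕ → (ℕ → ℕ) → List ℕ
fromMult zero f = []
fromMult (suc N) f = replicate (f (suc N)) (suc N) ++ fromMult N f

multiplicity-++ : ∀ s xs ys → multiplicity s (xs ++ ys) ≡ multiplicity s xs + multiplicity s ys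
multiplicity-++ s xs ys = trans (cong length (filter-++ (s ≟_) xs ys)) (length-++ (filter (s ≟_) xs))

multiplicity-replicate-≡ : ∀ s c → multiplicity s (replicate c s) ≡ c
multiplicity-replicate-≡ s zero = refl
multiplicity-replicate-≡ s (suc c) =
  trans (cong length (filter-accept (s ≟_) refl)) (cong suc (multiplicity-replicate-≡ s c))

multiplicity-replicate-≢ : ∀ {s x} c → s ≢ x → multiplicity s (replicate c x) ≡ 0
multiplicity-replicate-≢ zero s≢x = refl
multiplicity-replicate-≢ (suc c) s≢x =
  trans (cong length (filter-reject (_ ≟_) s≢x)) (multiplicity-replicate-≢ c s≢x)

multiplicity-fromMult-> : ∀ N f {s} → N < s → multiplicity s (fromMult N f) ≡ 0
multiplicity-fromMult-> zero f N<s = refl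
multiplicity-fromMult-> (suc N) f {s} N<s = begin
  multiplicity s (replicate (f (suc N)) (suc N) ++ fromMult N f)
    ≡⟨ multiplicity-++ s (replicate (f (suc N)) (suc N)) (fromMult N f) ⟩
  multiplicity s (replicate (f (suc N)) (suc N)) + multiplicity s (fromMult N f)
    ≡⟨ cong₂ _+_ (multiplicity-replicate-≢ (f (suc N)) (>⇒≢ N<s))
                 (multiplicity-fromMult-> N f (<-trans (n<1+n N) N<s)) ⟩
  0 ∎
  where open ≡-Reasoning

multiplicity-fromMult : ∀ N f {s} → InRange N s → multiplicity s (fromMult N f) ≡ f s
multiplicity-fromMult zero f (1≤s , s≤0) = contradiction (≤-trans 1≤s s≤0) λ ()
multiplicity-fromMult (suc N) f {s} (1≤s , s≤1+N) = begin
  multiplicity s (replicate (f (suc N)) (suc N) ++ fromMult N f)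
    ≡⟨ multiplicity-++ s (replicate (f (suc N)) (suc N)) (fromMult N f) ⟩
  multiplicity s (replicate (f (suc N)) (suc N)) + multiplicity s (fromMult N f)
    ≡⟨ split (m≤n⇒m<n∨m≡n s≤1+N) ⟩
  f s ∎
  where
  open ≡-Reasoning
  split : s < suc N ⊎ s ≡ suc N →
          multiplicity s (replicate (f (suc N)) (suc N)) + multiplicity s (fromMult N f) ≡ f s
  split (inj₁ s<1+N) = cong₂ _+_ (multiplicity-replicate-≢ (f (suc N)) (<⇒≢ s<1+N))
                                 (multiplicity-fromMult N f (1≤s , ≤-pred s<1+N))
  split (inj₂ refl) = trans (cong₂ _+_ (multiplicity-replicate-≡ s (f s)) (multiplicity-fromMult-> N f (n<1+n N)))
                            (+-identityʳ (f s))

mults-fromMult : ∀ N {f} → VanishesAbove N f → mults (fromMult N f) ≗⁺ f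
mults-fromMult N {f} f≡0 s 1≤s with s ≤? N
... | yes s≤N = multiplicity-fromMult N f (1≤s , s≤N)
... | no s≰N = trans (multiplicity-fromMult-> N f (≰⇒> s≰N)) (sym (f≡0 s (≰⇒> s≰N)))

fromMult-cong : ∀ N {f g} → (∀ s → InRange N s → f s ≡ g s) → fromMult N f ≡ fromMult N g
fromMult-cong zero f≗g = refl
fromMult-cong (suc N) f≗g =
  cong₂ (λ c → replicate c (suc N) ++_) (f≗g (suc N) (s≤s z≤n , ≤-refl))
        (fromMult-cong N (λ s (1≤s , s≤N) → f≗g s (1≤s , m≤n⇒m≤1+n s≤N)))

fromMult-inRange : ∀ N f → All (InRange N) (fromMult N f)
fromMult-inRange zero f = []
fromMult-inRange (suc N) f =
  All.++⁺ (All.replicate⁺ (f (suc N)) (s≤s z≤n , ≤-refl))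
          (All.map (λ (1≤s , s≤N) → 1≤s , m≤n⇒m≤1+n s≤N) (fromMult-inRange N f))

∷-sorted : ∀ {x xs} → All (_≤ x) xs → Linked _≥_ xs → Linked _≥_ (x ∷ xs)
∷-sorted [] _ = [-]
∷-sorted (y≤x ∷ _) sorted = y≤x ∷ sorted

replicate++-sorted : ∀ c {x xs} → All (_≤ x) xs → Linked _≥_ xs → Linked _≥_ (replicate c x ++ xs)
replicate++-sorted zero _ sorted = sorted
replicate++-sorted (suc c) xs≤x sorted =
  ∷-sorted (All.++⁺ (All.replicate⁺ c ≤-refl) xs≤x) (replicate++-sorted c xs≤x sorted)

fromMult-sorted : ∀ N f → Linked _≥_ (fromMult N f)
fromMult-sorted zero f = []
fromMult-sorted (suc N) f =
  replicate++-sorted (f (suc N)) (All.map (m≤n⇒m≤1+n ∘ proj₂) (fromMult-inRange N f)) (fromMult-sorted N f)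

sum-replicate : ∀ c x → sum (replicate c x) ≡ c * x
sum-replicate zero x = refl
sum-replicate (suc c) x = cong (x +_) (sum-replicate c x)

sum-fromMult : ∀ N f → sum (fromMult N f) ≡ weight N f
sum-fromMult zero f = refl
sum-fromMult (suc N) f = trans (sum-++ (replicate (f (suc N)) (suc N)) (fromMult N f))
  (cong₂ _+_ (trans (sum-replicate (f (suc N)) (suc N)) (*-comm (f (suc N)) (suc N))) (sum-fromMult N f))

sorted≡replicate++filter : ∀ N {ps} → Linked _≥_ ps → All (_≤ suc N) ps →
                           ps ≡ replicate (multiplicity (suc N) ps) (suc N) ++ filter (_≤? N) ps
sorted≡replicate++filter N {[]} _ _ = refl
sorted≡replicate++filter N {x ∷ xs} sorted (x≤1+N ∷ xs≤1+N) with x ≤? N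
... | yes x≤N = sym (cong₂ (λ c ys → replicate c (suc N) ++ ys) no-copies (filter-all (_≤? N) all≤N))
  where
  all≤N : All (_≤ N) (x ∷ xs)
  all≤N = Linked.Linked⇒All (flip ≤-trans) x≤N sorted
  no-copies : multiplicity (suc N) (x ∷ xs) ≡ 0
  no-copies = cong length (filter-none (suc N ≟_) (All.map (λ y≤N → >⇒≢ (s≤s y≤N)) all≤N))
... | no x≰N with ≤-antisym x≤1+N (≰⇒> x≰N)
...   | refl = begin
  suc N ∷ xs
    ≡⟨ cong (suc N ∷_) (sorted≡replicate++filter N (Linked.tail sorted) xs≤1+N) ⟩
  suc N ∷ replicate (multiplicity (suc N) xs) (suc N) ++ filter (_≤? N) xs
    ≡⟨ cong₂ (λ c ys → replicate c (suc N) ++ ys)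
             (cong length (filter-accept (suc N ≟_) refl)) (filter-reject (_≤? N) x≰N) ⟨
  replicate (multiplicity (suc N) (suc N ∷ xs)) (suc N) ++ filter (_≤? N) (suc N ∷ xs) ∎
  where open ≡-Reasoning

fromMult-mults : ∀ N {ps} → Linked _≥_ ps → All (InRange N) ps → fromMult N (mults ps) ≡ ps
fromMult-mults zero {[]} _ _ = refl
fromMult-mults zero {x ∷ _} _ ((1≤x , x≤0) ∷ _) = contradiction (≤-trans 1≤x x≤0) λ ()
fromMult-mults (suc N) {ps} sorted inRange = begin
  replicate (multiplicity (suc N) ps) (suc N) ++ fromMult N (mults ps)
    ≡⟨ cong (replicate (multiplicity (suc N) ps) (suc N) ++_)
            (trans (fromMult-cong N same-below) (fromMult-mults N sorted′ inRange′)) ⟩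
  replicate (multiplicity (suc N) ps) (suc N) ++ ps′
    ≡⟨ split ⟨
  ps ∎
  where
  open ≡-Reasoning
  ps′ : List ℕ
  ps′ = filter (_≤? N) ps
  split : ps ≡ replicate (multiplicity (suc N) ps) (suc N) ++ ps′
  split = sorted≡replicate++filter N sorted (All.map proj₂ inRange)
  sorted′ : Linked _≥_ ps′
  sorted′ = Linked.filter⁺ (_≤? N) (flip ≤-trans) sorted
  inRange′ : All (InRange N) ps′
  inRange′ = All.zip (All.filter⁺ (_≤? N) (All.map proj₁ inRange) , All.all-filter (_≤? N) ps)
  same-below : ∀ s → InRange N s → mults ps s ≡ mults ps′ s
  same-below s (_ , s≤N) = begin
    multiplicity s ps
      ≡⟨ cong (multiplicity s) split ⟩
    multiplicity s (replicate (multiplicity (suc N) ps) (suc N) ++ ps′)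
      ≡⟨ multiplicity-++ s (replicate (multiplicity (suc N) ps) (suc N)) ps′ ⟩
    multiplicity s (replicate (multiplicity (suc N) ps) (suc N)) + multiplicity s ps′
      ≡⟨ cong (_+ multiplicity s ps′)
              (multiplicity-replicate-≢ (multiplicity (suc N) ps) (<⇒≢ (s≤s s≤N))) ⟩
    multiplicity s ps′ ∎

IsPartitionMults : ℕ → (ℕ → ℕ) → Set
IsPartitionMults N f = VanishesAbove N f × weight N f ≡ N

all≤sum : ∀ ps → All (_≤ sum ps) ps
all≤sum [] = []
all≤sum (x ∷ xs) = m≤m+n x (sum xs) ∷ All.map (λ y≤sum → ≤-trans y≤sum (m≤n+m (sum xs) x)) (all≤sum xs)

partition-inRange : ∀ {N ps} → IsPartition N ps → All (InRange N) ps
partition-inRange {ps = ps} (positive , _ , refl) = All.zip (positive , all≤sum ps)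

fromMult-mults-partition : ∀ {N ps} → IsPartition N ps → fromMult N (mults ps) ≡ ps
fromMult-mults-partition π@(_ , sorted , _) = fromMult-mults _ sorted (partition-inRange π)

mults-isPartitionMults : ∀ {N ps} → IsPartition N ps → IsPartitionMults N (mults ps)
mults-isPartitionMults {N} {ps} π@(_ , _ , sum≡N) = vanishes , weight≡N
  where
  vanishes : VanishesAbove N (mults ps)
  vanishes s N<s =
    subst (λ qs → multiplicity s qs ≡ 0) (fromMult-mults-partition π) (multiplicity-fromMult-> N (mults ps) N<s)
  weight≡N : weight N (mults ps) ≡ N
  weight≡N = trans (sym (sum-fromMult N (mults ps))) (trans (cong sum (fromMult-mults-partition π)) sum≡N)

fromMult-isPartition : ∀ {N f} → weight N f ≡ N → IsPartition N (fromMult N f)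
fromMult-isPartition {N} {f} weight≡N =
  All.map proj₁ (fromMult-inRange N f) , fromMult-sorted N f , trans (sum-fromMult N f) weight≡N

weight-term≤ : ∀ {N f d} → IsPartitionMults N f → 1 ≤ d → d * f d ≤ N
weight-term≤ {N} {f} {d} (f≡0 , weight≡N) 1≤d with d ≤? N
... | yes d≤N = ≤-trans (term≤sumTo N (λ s → s * f s) (1≤d , d≤N)) (≤-reflexive weight≡N)
... | no d≰N = subst (_≤ N) (sym (trans (cong (d *_) (f≡0 d (≰⇒> d≰N))) (*-zeroʳ d))) z≤n

small-product⇒0 : ∀ {N s c} → N < s → s * c ≤ N → c ≡ 0
small-product⇒0 {c = zero} _ _ = refl
small-product⇒0 {s = s} {c = suc c} N<s sc≤N = contradiction (≤-trans (m≤m*n s (suc c)) sc≤N) (<⇒≱ N<s)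

isPartition-irrelevant : ∀ {N ps} (π π′ : IsPartition N ps) → π ≡ π′
isPartition-irrelevant (positive , sorted , sum≡N) (positive′ , sorted′ , sum≡N′) =
  cong₂ _,_ (All.irrelevant ≤-irrelevant positive positive′)
            (cong₂ _,_ (Linked.irrelevant ≤-irrelevant sorted sorted′) (≡-irrelevant sum≡N sum≡N′))

when : ∀ {P : Set} → Dec P → ℕ → ℕ
when (yes _) n = n
when (no _) _ = 0

unless : ∀ {P : Set} → Dec P → ℕ → ℕ
unless (yes _) _ = 0
unless (no _) n = n

when-yes : ∀ {P : Set} {n} → P → (P? : Dec P) → when P? n ≡ n
when-yes _ (yes _) = refl
when-yes p (no ¬p) = contradiction p ¬p

when-no : ∀ {P : Set} {n} → ¬ P → (P? : Dec P) → when P? n ≡ 0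
when-no ¬p (yes p) = contradiction p ¬p
when-no _ (no _) = refl

when-zero : ∀ {P : Set} (P? : Dec P) → when P? 0 ≡ 0
when-zero (yes _) = refl
when-zero (no _) = refl

when+unless : ∀ {P : Set} (P? : Dec P) n → when P? n + unless P? n ≡ n
when+unless (yes _) n = +-identityʳ n
when+unless (no _) n = refl

sumTo-split : ∀ {P : ℕ → Set} (P? : Decidable P) N F →
              sumTo F N ≡ sumTo (λ s → when (P? s) (F s)) N + sumTo (λ s → unless (P? s) (F s)) N
sumTo-split P? N F =
  trans (sumTo-cong N (λ s _ → sym (when+unless (P? s) (F s))))
        (sumTo-distrib-+ N (λ s → when (P? s) (F s)) (λ s → unless (P? s) (F s)))

sgn : ℕ → ℕ
sgn zero = 0
sgn (suc _) = 1

sgn-positive : ∀ {n} → 0 < n → sgn n ≡ 1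
sgn-positive {suc _} _ = refl

partSizes-∷-∷ : ∀ x xs → partSizes (x ∷ x ∷ xs) ≡ partSizes (x ∷ xs)
partSizes-∷-∷ x xs = cong (x ∷_) (trans (filter-reject (¬? ∘ (x ≟_)) (λ x≢x → x≢x refl))
                                        (filter-idem (¬? ∘ (x ≟_)) (partSizes xs)))

partSizes-∷-fresh : ∀ {x xs} → All (_< x) xs → partSizes (x ∷ xs) ≡ x ∷ partSizes xs
partSizes-∷-fresh {x} xs<x =
  cong (x ∷_) (filter-all (¬? ∘ (x ≟_)) (All.deduplicate⁺ _≟_ (All.map >⇒≢ xs<x)))

partSizes-replicate++ : ∀ c {x xs} → All (_< x) xs →
                        partSizes (replicate (suc c) x ++ xs) ≡ x ∷ partSizes xs
partSizes-replicate++ zero xs<x = partSizes-∷-fresh xs<x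
partSizes-replicate++ (suc c) {x} {xs} xs<x =
  trans (partSizes-∷-∷ x (replicate c x ++ xs)) (partSizes-replicate++ c xs<x)

length-filter-partSizes-fromMult : ∀ {P : ℕ → Set} (P? : Decidable P) N f →
  length (filter P? (partSizes (fromMult N f))) ≡ sumTo (λ s → when (P? s) (sgn (f s))) N
length-filter-partSizes-fromMult P? zero f = refl
length-filter-partSizes-fromMult {P} P? (suc N) f = step (f (suc N)) (P? (suc N))
  where
  IH : length (filter P? (partSizes (fromMult N f))) ≡ sumTo (λ s → when (P? s) (sgn (f s))) N
  IH = length-filter-partSizes-fromMult P? N f
  below : All (_< suc N) (fromMult N f)
  below = All.map (s≤s ∘ proj₂) (fromMult-inRange N f)
  step : ∀ c (P[1+N]? : Dec (P (suc N))) →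
         length (filter P? (partSizes (replicate c (suc N) ++ fromMult N f)))
           ≡ when P[1+N]? (sgn c) + sumTo (λ s → when (P? s) (sgn (f s))) N
  step zero (yes _) = IH
  step zero (no _) = IH
  step (suc c) (yes P[1+N]) = trans (cong (length ∘ filter P?) (partSizes-replicate++ c below))
                                   (trans (cong length (filter-accept P? P[1+N])) (cong suc IH))
  step (suc c) (no ¬P[1+N]) = trans (cong (length ∘ filter P?) (partSizes-replicate++ c below))
                                    (trans (cong length (filter-reject P? ¬P[1+N])) IH)

numDivSizes-fromMult : ∀ p N f →
                       numDivSizes p (fromMult N f) ≡ sumTo (λ s → when (2 ^ p ∣? s) (sgn (f s))) N
numDivSizes-fromMult p = length-filter-partSizes-fromMult (2 ^ p ∣?_)

numFreqSizes-fromMult : ∀ p N f →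
                        numFreqSizes p (fromMult N f) ≡ sumTo (λ s → when (2 ^ p ≤? f s) (sgn (f s))) N
numFreqSizes-fromMult p N f =
  trans (length-filter-partSizes-fromMult (λ m → 2 ^ p ≤? multiplicity m (fromMult N f)) N f)
        (sumTo-cong N (λ s s∈ → cong (λ c → when (2 ^ p ≤? c) (sgn (f s))) (multiplicity-fromMult N f s∈)))

-- Bijections of multiplicity functions induce bijections of partitions

record MultsBijection (N : ℕ) : Set where
  field
    to from : (ℕ → ℕ) → ℕ → ℕ
    to-cong : ∀ {f g} → f ≗⁺ g → to f ≗⁺ to g
    from-cong : ∀ {f g} → f ≗⁺ g → from f ≗⁺ from g
    to-valid : ∀ {f} → IsPartitionMults N f → IsPartitionMults N (to f)
    from-valid : ∀ {g} → IsPartitionMults N g → IsPartitionMults N (from g)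
    from∘to : ∀ {f} → IsPartitionMults N f → from (to f) ≗⁺ f
    to∘from : ∀ {g} → IsPartitionMults N g → to (from g) ≗⁺ g

Partition-with : ℕ → (List ℕ → ℕ) → ℕ → Set
Partition-with N stat k = Σ (Partition N) (λ π → stat (proj₁ π) ≡ k)

Partition-with-≡ : ∀ {N stat k} {x y : Partition-with N stat k} →
                   proj₁ (proj₁ x) ≡ proj₁ (proj₁ y) → x ≡ y
Partition-with-≡ {x = (ps , π) , e} {y = (.ps , π′) , e′} refl
  with refl ← isPartition-irrelevant π π′ | refl ← ≡-irrelevant e e′ = refl

partitionBijection : ∀ {N} (φ : MultsBijection N) (statA statB : List ℕ → ℕ) →
  (∀ {f} → IsPartitionMults N f → statB (fromMult N (MultsBijection.to φ f)) ≡ statA (fromMult N f)) →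
  ∀ k → Partition-with N statA k ⤖ Partition-with N statB k
partitionBijection {N} φ statA statB stat k = ↔⇒⤖ (mk↔ₛ′ forward backward forward∘backward backward∘forward)
  where
  open MultsBijection φ
  open ≡-Reasoning

  fromMult-cong⁺ : ∀ {f g} → f ≗⁺ g → fromMult N f ≡ fromMult N g
  fromMult-cong⁺ f≗g = fromMult-cong N (λ s (1≤s , _) → f≗g s 1≤s)

  realise : ∀ {f} → IsPartitionMults N f → Partition N
  realise {f} (_ , weight≡N) = fromMult N f , fromMult-isPartition weight≡N

  forward : Partition-with N statA k → Partition-with N statB k
  forward ((ps , π) , statA≡k) = realise (to-valid f-valid) , (begin
    statB (fromMult N (to (mults ps))) ≡⟨ stat f-valid ⟩
    statA (fromMult N (mults ps))      ≡⟨ cong statA (fromMult-mults-partition π) ⟩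
    statA ps                           ≡⟨ statA≡k ⟩
    k                                  ∎)
    where
    f-valid : IsPartitionMults N (mults ps)
    f-valid = mults-isPartitionMults π

  backward : Partition-with N statB k → Partition-with N statA k
  backward ((qs , π) , statB≡k) = realise (from-valid g-valid) , (begin
    statA (fromMult N (from (mults qs)))      ≡⟨ stat (from-valid g-valid) ⟨
    statB (fromMult N (to (from (mults qs)))) ≡⟨ cong statB (fromMult-cong⁺ (to∘from g-valid)) ⟩
    statB (fromMult N (mults qs))             ≡⟨ cong statB (fromMult-mults-partition π) ⟩
    statB qs                                  ≡⟨ statB≡k ⟩
    k                                         ∎)
    where
    g-valid : IsPartitionMults N (mults qs)
    g-valid = mults-isPartitionMults π

  forward∘backward : ∀ y → forward (backward y) ≡ y
  forward∘backward ((qs , π) , _) = Partition-with-≡ (begin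
    fromMult N (to (mults (fromMult N (from (mults qs)))))
      ≡⟨ fromMult-cong⁺ (to-cong (mults-fromMult N (proj₁ (from-valid g-valid)))) ⟩
    fromMult N (to (from (mults qs)))  ≡⟨ fromMult-cong⁺ (to∘from g-valid) ⟩
    fromMult N (mults qs)              ≡⟨ fromMult-mults-partition π ⟩
    qs                                 ∎)
    where
    g-valid : IsPartitionMults N (mults qs)
    g-valid = mults-isPartitionMults π

  backward∘forward : ∀ x → backward (forward x) ≡ x
  backward∘forward ((ps , π) , _) = Partition-with-≡ (begin
    fromMult N (from (mults (fromMult N (to (mults ps)))))
      ≡⟨ fromMult-cong⁺ (from-cong (mults-fromMult N (proj₁ (to-valid f-valid)))) ⟩
    fromMult N (from (to (mults ps)))  ≡⟨ fromMult-cong⁺ (from∘to f-valid) ⟩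
    fromMult N (mults ps)              ≡⟨ fromMult-mults-partition π ⟩
    ps                                 ∎)
    where
    f-valid : IsPartitionMults N (mults ps)
    f-valid = mults-isPartitionMults π

-- Glaisher's bijection

module Glaisher (M : ℕ) .{{_ : NonZero M}} (1<M : 1 < M) where

  M*d/M≡d : ∀ d → M * d / M ≡ d
  M*d/M≡d d = trans (cong (_/ M) (*-comm M d)) (m*n/n≡m d M)

  [M*a+r]/M≡a : ∀ a {r} → r < M → (M * a + r) / M ≡ a
  [M*a+r]/M≡a a {r} r<M = begin
    (M * a + r) / M    ≡⟨ +-distrib-/-∣ˡ r (m∣m*n a) ⟩
    M * a / M + r / M  ≡⟨ cong₂ _+_ (M*d/M≡d a) (m<n⇒m/n≡0 r<M) ⟩
    a + 0              ≡⟨ +-identityʳ a ⟩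
    a                  ∎
    where open ≡-Reasoning

  [M*a+r]%M≡r : ∀ a {r} → r < M → (M * a + r) % M ≡ r
  [M*a+r]%M≡r a {r} r<M = begin
    (M * a + r) % M  ≡⟨ cong (_% M) (trans (+-comm (M * a) r) (cong (r +_) (*-comm M a))) ⟩
    (r + a * M) % M  ≡⟨ [m+kn]%n≡m%n r a M ⟩
    r % M            ≡⟨ m<n⇒m%n≡m r<M ⟩
    r                ∎
    where open ≡-Reasoning

  M*[x/M]+x%M≡x : ∀ x → M * (x / M) + x % M ≡ x
  M*[x/M]+x%M≡x x = begin
    M * (x / M) + x % M  ≡⟨ +-comm (M * (x / M)) (x % M) ⟩
    x % M + M * (x / M)  ≡⟨ cong (x % M +_) (*-comm M (x / M)) ⟩
    x % M + x / M * M    ≡⟨ m≡m%n+[m/n]*n x M ⟨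
    x                    ∎
    where open ≡-Reasoning

  0%M≡0 : 0 % M ≡ 0
  0%M≡0 = m<n⇒m%n≡m (<-trans z<s 1<M)

  M*q*[x/M]≤q*x : ∀ q x → M * q * (x / M) ≤ q * x
  M*q*[x/M]≤q*x q x = begin
    M * q * (x / M)  ≡⟨ cong (_* (x / M)) (*-comm M q) ⟩
    q * M * (x / M)  ≡⟨ *-assoc q M (x / M) ⟩
    q * (M * (x / M)) ≡⟨ cong (q *_) (*-comm M (x / M)) ⟩
    q * (x / M * M)  ≤⟨ *-monoʳ-≤ q (m/n*n≤m x M) ⟩
    q * x            ∎
    where open ≤-Reasoning

  n<M^n : ∀ n → n < M ^ n
  n<M^n zero = s≤s z≤n
  n<M^n (suc n) = begin-strict
    suc n          ≤⟨ n<M^n n ⟩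
    M ^ n          <⟨ m<m+n (M ^ n) (m^n>0 M n) ⟩
    M ^ n + M ^ n  ≡⟨ cong (M ^ n +_) (+-identityʳ (M ^ n)) ⟨
    2 * M ^ n      ≤⟨ *-monoˡ-≤ (M ^ n) 1<M ⟩
    M * M ^ n      ∎
    where open ≤-Reasoning

  M^k*[M*d]≡M^[1+k]*d : ∀ k d → M ^ k * (M * d) ≡ M ^ suc k * d
  M^k*[M*d]≡M^[1+k]*d k d = trans (sym (*-assoc (M ^ k) M d)) (cong (_* d) (*-comm (M ^ k) M))

  /M-positive : ∀ {d} → M ∣ d → 1 ≤ d → 1 ≤ d / M
  /M-positive {suc d} M∣d _ = n≢0⇒n>0 (λ d/M≡0 → <⇒≱ (m/n≡0⇒m<n d/M≡0) (∣⇒≤ M∣d))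

  /M-< : ∀ {d} → 1 ≤ d → d / M < d
  /M-< {suc d} _ = m/n<m (suc d) M 1<M

  ∤-non-multiple : ∀ {i} N → suc i < M → ¬ M ∣ suc i + M * N
  ∤-non-multiple {i} N 1+i<M M∣1+i+MN =
    <⇒≱ 1+i<M (∣⇒≤ (∣m+n∣m⇒∣n (subst (M ∣_) (+-comm (suc i) (M * N)) M∣1+i+MN) (m∣m*n N)))

  sumTo-multiplesOf : ∀ (F : ℕ → ℕ) N →
                      sumTo (λ s → when (M ∣? s) (F s)) (M * N) ≡ sumTo (λ d → F (M * d)) N
  sumTo-multiplesOf F zero = cong (sumTo (λ s → when (M ∣? s) (F s))) (*-zeroʳ M)
  sumTo-multiplesOf F (suc N) = begin
    sumTo G (M * suc N)
      ≡⟨ cong (sumTo G) M*[1+N]≡1+[M-1+M*N] ⟩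
    G (suc (pred M + M * N)) + sumTo G (pred M + M * N)
      ≡⟨ cong₂ _+_ (trans (cong G (sym M*[1+N]≡1+[M-1+M*N])) (when-yes (m∣m*n (suc N)) (M ∣? (M * suc N))))
                   (trans (skip-non-multiples (pred M) M-1<M) (sumTo-multiplesOf F N)) ⟩
    F (M * suc N) + sumTo (λ d → F (M * d)) N ∎
    where
    open ≡-Reasoning
    G : ℕ → ℕ
    G s = when (M ∣? s) (F s)
    M*[1+N]≡1+[M-1+M*N] : M * suc N ≡ suc (pred M + M * N)
    M*[1+N]≡1+[M-1+M*N] = trans (*-suc M N) (cong (_+ M * N) (sym (suc-pred M)))
    M-1<M : pred M < M
    M-1<M = subst (pred M <_) (suc-pred M) (n<1+n (pred M))
    skip-non-multiples : ∀ i → i < M → sumTo G (i + M * N) ≡ sumTo G (M * N)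
    skip-non-multiples zero _ = refl
    skip-non-multiples (suc i) 1+i<M =
      trans (cong (_+ sumTo G (i + M * N)) (when-no (∤-non-multiple N 1+i<M) (M ∣? (suc i + M * N))))
            (skip-non-multiples i (<-trans (n<1+n i) 1+i<M))

  sumTo-multiples : ∀ N {F} → VanishesAbove N F →
                    sumTo (λ d → F (M * d)) N ≡ sumTo (λ s → when (M ∣? s) (F s)) N
  sumTo-multiples N {F} F≡0 =
    trans (sym (sumTo-multiplesOf F N))
          (sumTo-vanishing (m≤n*m N M)
                           (λ s N<s → trans (cong (when (M ∣? s)) (F≡0 s N<s)) (when-zero (M ∣? s))))

  -- carry f (M ^ j * d₀) = f d₀ / M ^ j for M ∤ d₀, so carry f d % M is the j-th base-M digit
  -- of f d₀; the fuel d suffices since d / M < d.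
  carryWith : ℕ → (ℕ → ℕ) → ℕ → ℕ
  carryWith zero f d = f d
  carryWith (suc k) f d with M ∣? d
  ... | yes _ = carryWith k f (d / M) / M
  ... | no _ = f d

  carry : (ℕ → ℕ) → ℕ → ℕ
  carry f d = carryWith d f d

  carryWith-fuel : ∀ f {k k′ d} → 1 ≤ d → d ≤ k → d ≤ k′ → carryWith k f d ≡ carryWith k′ f d
  carryWith-fuel f {zero} 1≤d d≤0 _ = contradiction (≤-trans 1≤d d≤0) λ ()
  carryWith-fuel f {suc k} {zero} 1≤d _ d≤0 = contradiction (≤-trans 1≤d d≤0) λ ()
  carryWith-fuel f {suc k} {suc k′} {d} 1≤d d≤1+k d≤1+k′ with M ∣? d
  ... | yes M∣d = cong (_/ M) (carryWith-fuel f (/M-positive M∣d 1≤d)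
                    (≤-pred (≤-trans (/M-< 1≤d) d≤1+k)) (≤-pred (≤-trans (/M-< 1≤d) d≤1+k′)))
  ... | no _ = refl

  carryWith-∣ : ∀ f k {d} → M ∣ d → carryWith (suc k) f d ≡ carryWith k f (d / M) / M
  carryWith-∣ f k {d} M∣d with M ∣? d
  ... | yes _ = refl
  ... | no M∤d = contradiction M∣d M∤d

  carryWith-cong : ∀ {f g} → f ≗⁺ g → ∀ k {d} → 1 ≤ d → carryWith k f d ≡ carryWith k g d
  carryWith-cong f≗g zero 1≤d = f≗g _ 1≤d
  carryWith-cong f≗g (suc k) {d} 1≤d with M ∣? d
  ... | yes M∣d = cong (_/ M) (carryWith-cong f≗g k (/M-positive M∣d 1≤d))
  ... | no _ = f≗g d 1≤d

  carry-∤ : ∀ f {d} → ¬ M ∣ d → carry f d ≡ f d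
  carry-∤ f {zero} _ = refl
  carry-∤ f {suc d} M∤d with M ∣? suc d
  ... | yes M∣d = contradiction M∣d M∤d
  ... | no _ = refl

  carry-M* : ∀ f {d} → 1 ≤ d → carry f (M * d) ≡ carry f d / M
  carry-M* f {d} 1≤d = begin
    carryWith (M * d) f (M * d)         ≡⟨ carryWith-fuel f 1≤Md ≤-refl (n≤1+n (M * d)) ⟩
    carryWith (suc (M * d)) f (M * d)   ≡⟨ carryWith-∣ f (M * d) (m∣m*n d) ⟩
    carryWith (M * d) f (M * d / M) / M ≡⟨ cong (λ x → carryWith (M * d) f x / M) (M*d/M≡d d) ⟩
    carryWith (M * d) f d / M           ≡⟨ cong (_/ M) (carryWith-fuel f 1≤d (m≤n*m d M) ≤-refl) ⟩
    carryWith d f d / M                 ∎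
    where
    open ≡-Reasoning
    1≤Md : 1 ≤ M * d
    1≤Md = ≤-trans 1≤d (m≤n*m d M)

  carryWith-bound : ∀ {N f} → IsPartitionMults N f → ∀ k {d} → 1 ≤ d → d * carryWith k f d ≤ N
  carryWith-bound valid zero 1≤d = weight-term≤ valid 1≤d
  carryWith-bound {N} {f} valid (suc k) {d} 1≤d with M ∣? d
  ... | yes M∣d = begin
    d * (x / M)      ≡⟨ cong (_* (x / M)) (m*[n/m]≡n M∣d) ⟨
    M * q * (x / M)  ≤⟨ M*q*[x/M]≤q*x q x ⟩
    q * x            ≤⟨ carryWith-bound valid k (/M-positive M∣d 1≤d) ⟩
    N                ∎
    where
    open ≤-Reasoning
    q x : ℕ
    q = d / M
    x = carryWith k f q
  ... | no _ = weight-term≤ valid 1≤d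

  carry-vanishesAbove : ∀ {N f} → IsPartitionMults N f → VanishesAbove N (carry f)
  carry-vanishesAbove valid s N<s = small-product⇒0 N<s (carryWith-bound valid s (≤-trans (s≤s z≤n) N<s))

  glaisher : (ℕ → ℕ) → ℕ → ℕ
  glaisher f d = M * f (M * d) + carry f d % M

  glaisher-cong : ∀ {f g} → f ≗⁺ g → glaisher f ≗⁺ glaisher g
  glaisher-cong f≗g d 1≤d =
    cong₂ _+_ (cong (M *_) (f≗g (M * d) (≤-trans 1≤d (m≤n*m d M)))) (cong (_% M) (carryWith-cong f≗g d 1≤d))

  glaisher-vanishesAbove : ∀ {N f} → VanishesAbove N f → VanishesAbove N (carry f) →
                           VanishesAbove N (glaisher f)
  glaisher-vanishesAbove f≡0 carry≡0 d N<d =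
    cong₂ _+_ (trans (cong (M *_) (f≡0 (M * d) (<-≤-trans N<d (m≤n*m d M)))) (*-zeroʳ M))
              (trans (cong (_% M) (carry≡0 d N<d)) 0%M≡0)

  glaisher-balance : ∀ f {d} → 1 ≤ d →
                     d * glaisher f d + M * d * carry f (M * d) ≡ M * d * f (M * d) + d * carry f d
  glaisher-balance f {d} 1≤d = begin
    d * (M * f (M * d) + c % M) + M * d * carry f (M * d)
      ≡⟨ cong (λ y → d * (M * f (M * d) + c % M) + M * d * y) (carry-M* f 1≤d) ⟩
    d * (M * f (M * d) + c % M) + M * d * (c / M)
      ≡⟨ solve 5 (λ d m a r q → d :* (m :* a :+ r) :+ m :* d :* q := m :* d :* a :+ d :* (m :* q :+ r))
               refl d M (f (M * d)) (c % M) (c / M) ⟩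
    M * d * f (M * d) + d * (M * (c / M) + c % M)
      ≡⟨ cong (λ y → M * d * f (M * d) + d * y) (M*[x/M]+x%M≡x c) ⟩
    M * d * f (M * d) + d * c ∎
    where
    open ≡-Reasoning
    open +-*-Solver
    c : ℕ
    c = carry f d

  -- Summing glaisher-balance over d, the carries at multiples of M occur on both sides, and
  -- away from multiples of M the carry is f itself.
  weight-glaisher : ∀ {N f} → VanishesAbove N f → VanishesAbove N (carry f) →
                    weight N (glaisher f) ≡ weight N f
  weight-glaisher {N} {f} f≡0 carry≡0 = +-cancelʳ-≡ (onMultiples (carry f)) _ _ (begin
    weight N (glaisher f) + onMultiples (carry f)
      ≡⟨ cong (weight N (glaisher f) +_) (sumTo-multiples N (scaled≡0 carry≡0)) ⟨
    weight N (glaisher f) + sumTo (λ d → M * d * carry f (M * d)) N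
      ≡⟨ sumTo-distrib-+ N (λ d → d * glaisher f d) (λ d → M * d * carry f (M * d)) ⟨
    sumTo (λ d → d * glaisher f d + M * d * carry f (M * d)) N
      ≡⟨ sumTo-cong N (λ d (1≤d , _) → glaisher-balance f 1≤d) ⟩
    sumTo (λ d → M * d * f (M * d) + d * carry f d) N
      ≡⟨ sumTo-distrib-+ N (λ d → M * d * f (M * d)) (λ d → d * carry f d) ⟩
    sumTo (λ d → M * d * f (M * d)) N + weight N (carry f)
      ≡⟨ cong₂ _+_ (sumTo-multiples N (scaled≡0 f≡0)) (sumTo-split (M ∣?_) N (λ s → s * carry f s)) ⟩
    onMultiples f + (onMultiples (carry f) + offMultiples (carry f))
      ≡⟨ cong (λ z → onMultiples f + (onMultiples (carry f) + z)) (sumTo-cong N carry≗f-off) ⟩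
    onMultiples f + (onMultiples (carry f) + offMultiples f)
      ≡⟨ trans (cong (onMultiples f +_) (+-comm _ (offMultiples f))) (sym (+-assoc (onMultiples f) _ _)) ⟩
    onMultiples f + offMultiples f + onMultiples (carry f)
      ≡⟨ cong (_+ onMultiples (carry f)) (sumTo-split (M ∣?_) N (λ s → s * f s)) ⟨
    weight N f + onMultiples (carry f) ∎)
    where
    open ≡-Reasoning
    onMultiples offMultiples : (ℕ → ℕ) → ℕ
    onMultiples h = sumTo (λ s → when (M ∣? s) (s * h s)) N
    offMultiples h = sumTo (λ s → unless (M ∣? s) (s * h s)) N
    scaled≡0 : ∀ {h} → VanishesAbove N h → VanishesAbove N (λ s → s * h s)
    scaled≡0 h≡0 s N<s = trans (cong (s *_) (h≡0 s N<s)) (*-zeroʳ s)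
    carry≗f-off : ∀ s → InRange N s → unless (M ∣? s) (s * carry f s) ≡ unless (M ∣? s) (s * f s)
    carry≗f-off s _ with M ∣? s
    ... | yes _ = refl
    ... | no M∤s = cong (s *_) (carry-∤ f M∤s)

  when[M≤M*a+r]≡sgn[a] : ∀ a {r} → r < M → when (M ≤? M * a + r) (sgn (M * a + r)) ≡ sgn a
  when[M≤M*a+r]≡sgn[a] zero {r} r<M =
    when-no (λ M≤M*0+r → <⇒≱ r<M (subst (M ≤_) (cong (_+ r) (*-zeroʳ M)) M≤M*0+r)) (M ≤? M * 0 + r)
  when[M≤M*a+r]≡sgn[a] (suc a) {r} _ =
    trans (when-yes M≤x (M ≤? x)) (sgn-positive (<-≤-trans (<-trans z<s 1<M) M≤x))
    where
    x : ℕ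
    x = M * suc a + r
    M≤x : M ≤ x
    M≤x = ≤-trans (m≤m*n M (suc a)) (m≤m+n (M * suc a) r)

  count-glaisher : ∀ {N f} → VanishesAbove N f →
                   sumTo (λ s → when (M ≤? glaisher f s) (sgn (glaisher f s))) N
                     ≡ sumTo (λ s → when (M ∣? s) (sgn (f s))) N
  count-glaisher {N} {f} f≡0 =
    trans (sumTo-cong N (λ d _ → when[M≤M*a+r]≡sgn[a] (f (M * d)) (m%n<n (carry f d) M)))
          (sumTo-multiples N (λ s N<s → cong sgn (f≡0 s N<s)))

  -- assembleDigits k g d = Σ_{j<k} M ^ j * (g (M ^ j * d) % M). In glaisher⁻¹ N, suc N digits
  -- suffice, as g vanishes at M ^ j * d > N.
  assembleDigits : ℕ → (ℕ → ℕ) → ℕ → ℕ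
  assembleDigits zero g d = 0
  assembleDigits (suc k) g d = M * assembleDigits k g (M * d) + g d % M

  glaisher⁻¹ : ℕ → (ℕ → ℕ) → ℕ → ℕ
  glaisher⁻¹ N g s with M ∣? s
  ... | yes _ = g (s / M) / M
  ... | no _ = assembleDigits (suc N) g s

  glaisher⁻¹-∣ : ∀ N g {s} → M ∣ s → glaisher⁻¹ N g s ≡ g (s / M) / M
  glaisher⁻¹-∣ N g {s} M∣s with M ∣? s
  ... | yes _ = refl
  ... | no M∤s = contradiction M∣s M∤s

  glaisher⁻¹-∤ : ∀ N g {s} → ¬ M ∣ s → glaisher⁻¹ N g s ≡ assembleDigits (suc N) g s
  glaisher⁻¹-∤ N g {s} M∤s with M ∣? s
  ... | yes M∣s = contradiction M∣s M∤s
  ... | no _ = refl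

  assembleDigits-cong : ∀ {f g} → f ≗⁺ g → ∀ k {d} → 1 ≤ d → assembleDigits k f d ≡ assembleDigits k g d
  assembleDigits-cong f≗g zero 1≤d = refl
  assembleDigits-cong f≗g (suc k) {d} 1≤d =
    cong₂ _+_ (cong (M *_) (assembleDigits-cong f≗g k (≤-trans 1≤d (m≤n*m d M)))) (cong (_% M) (f≗g d 1≤d))

  glaisher⁻¹-cong : ∀ N {f g} → f ≗⁺ g → glaisher⁻¹ N f ≗⁺ glaisher⁻¹ N g
  glaisher⁻¹-cong N f≗g s 1≤s with M ∣? s
  ... | yes M∣s = cong (_/ M) (f≗g (s / M) (/M-positive M∣s 1≤s))
  ... | no _ = assembleDigits-cong f≗g (suc N) 1≤s

  assembleDigits-glaisher : ∀ {N f} → VanishesAbove N (carry f) →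
                            ∀ k {d} → 1 ≤ d → N < M ^ k * d → assembleDigits k (glaisher f) d ≡ carry f d
  assembleDigits-glaisher carry≡0 zero {d} _ N<d = sym (carry≡0 d (subst (_ <_) (*-identityˡ d) N<d))
  assembleDigits-glaisher {N} {f} carry≡0 (suc k) {d} 1≤d N<M^[1+k]*d = begin
    M * assembleDigits k (glaisher f) (M * d) + glaisher f d % M
      ≡⟨ cong₂ _+_ (cong (M *_) (trans (assembleDigits-glaisher carry≡0 k (≤-trans 1≤d (m≤n*m d M))
                                          (subst (N <_) (sym (M^k*[M*d]≡M^[1+k]*d k d)) N<M^[1+k]*d))
                                       (carry-M* f 1≤d)))
                   ([M*a+r]%M≡r (f (M * d)) (m%n<n (carry f d) M)) ⟩
    M * (carry f d / M) + carry f d % M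
      ≡⟨ M*[x/M]+x%M≡x (carry f d) ⟩
    carry f d ∎
    where open ≡-Reasoning

  glaisher⁻¹∘glaisher : ∀ {N f} → VanishesAbove N (carry f) → glaisher⁻¹ N (glaisher f) ≗⁺ f
  glaisher⁻¹∘glaisher {N} {f} carry≡0 s 1≤s with M ∣? s
  ... | yes M∣s = trans ([M*a+r]/M≡a (f (M * (s / M))) (m%n<n _ M)) (cong f (m*[n/m]≡n M∣s))
  ... | no M∤s = trans (assembleDigits-glaisher carry≡0 (suc N) 1≤s N<M^[1+N]*s) (carry-∤ f M∤s)
    where
    N<M^[1+N]*s : N < M ^ suc N * s
    N<M^[1+N]*s = <-≤-trans (<-trans (n<1+n N) (n<M^n (suc N))) (m≤m*n (M ^ suc N) s {{>-nonZero 1≤s}})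

  assembleDigits-vanishesAbove : ∀ {N g} → VanishesAbove N g → ∀ k {d} → N < d → assembleDigits k g d ≡ 0
  assembleDigits-vanishesAbove g≡0 zero N<d = refl
  assembleDigits-vanishesAbove g≡0 (suc k) {d} N<d =
    cong₂ _+_ (trans (cong (M *_) (assembleDigits-vanishesAbove g≡0 k (<-≤-trans N<d (m≤n*m d M))))
                     (*-zeroʳ M))
              (trans (cong (_% M) (g≡0 d N<d)) 0%M≡0)

  assembleDigits-stable : ∀ {N g} → VanishesAbove N g →
                          ∀ k {d} → N < M ^ k * d → assembleDigits (suc k) g d ≡ assembleDigits k g d
  assembleDigits-stable g≡0 zero {d} N<d =
    cong₂ _+_ (*-zeroʳ M) (trans (cong (_% M) (g≡0 d (subst (_ <_) (*-identityˡ d) N<d))) 0%M≡0)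
  assembleDigits-stable {N} {g} g≡0 (suc k) {d} N<M^[1+k]*d =
    cong (λ y → M * y + g d % M)
         (assembleDigits-stable g≡0 k (subst (N <_) (sym (M^k*[M*d]≡M^[1+k]*d k d)) N<M^[1+k]*d))

  carry-glaisher⁻¹ : ∀ {N g} → VanishesAbove N g →
                     ∀ k {d} → 1 ≤ d → d ≤ k → carryWith k (glaisher⁻¹ N g) d ≡ assembleDigits (suc N) g d
  carry-glaisher⁻¹ g≡0 zero 1≤d d≤0 = contradiction (≤-trans 1≤d d≤0) λ ()
  carry-glaisher⁻¹ {N} {g} g≡0 (suc k) {d} 1≤d d≤1+k with M ∣? d
  ... | yes M∣d = begin
    carryWith k (glaisher⁻¹ N g) q / M
      ≡⟨ cong (_/ M) (carry-glaisher⁻¹ g≡0 k 1≤q (≤-pred (≤-trans (/M-< 1≤d) d≤1+k))) ⟩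
    (M * assembleDigits N g (M * q) + g q % M) / M
      ≡⟨ [M*a+r]/M≡a (assembleDigits N g (M * q)) (m%n<n (g q) M) ⟩
    assembleDigits N g (M * q)
      ≡⟨ assembleDigits-stable g≡0 N N<M^N*[M*q] ⟨
    assembleDigits (suc N) g (M * q)
      ≡⟨ cong (assembleDigits (suc N) g) (m*[n/m]≡n M∣d) ⟩
    assembleDigits (suc N) g d ∎
    where
    open ≡-Reasoning
    q : ℕ
    q = d / M
    1≤q : 1 ≤ q
    1≤q = /M-positive M∣d 1≤d
    N<M^N*[M*q] : N < M ^ N * (M * q)
    N<M^N*[M*q] = <-≤-trans (n<M^n N) (m≤m*n (M ^ N) (M * q) {{>-nonZero (≤-trans 1≤q (m≤n*m q M))}})
  ... | no M∤d = glaisher⁻¹-∤ N g M∤d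

  glaisher∘glaisher⁻¹ : ∀ {N g} → VanishesAbove N g → glaisher (glaisher⁻¹ N g) ≗⁺ g
  glaisher∘glaisher⁻¹ {N} {g} g≡0 d 1≤d = begin
    M * glaisher⁻¹ N g (M * d) + carry (glaisher⁻¹ N g) d % M
      ≡⟨ cong₂ _+_ (cong (M *_) (trans (glaisher⁻¹-∣ N g (m∣m*n d)) (cong (λ y → g y / M) (M*d/M≡d d))))
                   (cong (_% M) (carry-glaisher⁻¹ g≡0 d 1≤d ≤-refl)) ⟩
    M * (g d / M) + (M * assembleDigits N g (M * d) + g d % M) % M
      ≡⟨ cong (M * (g d / M) +_) ([M*a+r]%M≡r (assembleDigits N g (M * d)) (m%n<n (g d) M)) ⟩
    M * (g d / M) + g d % M
      ≡⟨ M*[x/M]+x%M≡x (g d) ⟩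
    g d ∎
    where open ≡-Reasoning

  glaisher⁻¹-vanishesAbove : ∀ {N g} → IsPartitionMults N g → VanishesAbove N (glaisher⁻¹ N g)
  glaisher⁻¹-vanishesAbove {N} {g} valid@(g≡0 , _) s N<s with M ∣? s
  ... | yes M∣s = small-product⇒0 N<s (begin
    s * (g q / M)      ≡⟨ cong (_* (g q / M)) (m*[n/m]≡n M∣s) ⟨
    M * q * (g q / M)  ≤⟨ M*q*[x/M]≤q*x q (g q) ⟩
    q * g q            ≤⟨ weight-term≤ valid (/M-positive M∣s (≤-trans (s≤s z≤n) N<s)) ⟩
    N                  ∎)
    where
    open ≤-Reasoning
    q : ℕ
    q = s / M
  ... | no _ = assembleDigits-vanishesAbove g≡0 (suc N) N<s

  carry-glaisher⁻¹-vanishesAbove : ∀ {N g} → VanishesAbove N g → VanishesAbove N (carry (glaisher⁻¹ N g))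
  carry-glaisher⁻¹-vanishesAbove {N} g≡0 s N<s =
    trans (carry-glaisher⁻¹ g≡0 s (≤-trans (s≤s z≤n) N<s) ≤-refl)
          (assembleDigits-vanishesAbove g≡0 (suc N) N<s)

  glaisher-valid : ∀ {N f} → IsPartitionMults N f → IsPartitionMults N (glaisher f)
  glaisher-valid {N} {f} valid@(f≡0 , weight≡N) =
    glaisher-vanishesAbove f≡0 carry≡0 , trans (weight-glaisher f≡0 carry≡0) weight≡N
    where
    carry≡0 : VanishesAbove N (carry f)
    carry≡0 = carry-vanishesAbove valid

  glaisher⁻¹-valid : ∀ {N g} → IsPartitionMults N g → IsPartitionMults N (glaisher⁻¹ N g)
  glaisher⁻¹-valid {N} {g} valid@(g≡0 , weight≡N) = glaisher⁻¹-vanishesAbove valid , (begin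
    weight N (glaisher⁻¹ N g)
      ≡⟨ weight-glaisher (glaisher⁻¹-vanishesAbove valid) (carry-glaisher⁻¹-vanishesAbove g≡0) ⟨
    weight N (glaisher (glaisher⁻¹ N g))
      ≡⟨ sumTo-cong N (λ s (1≤s , _) → cong (s *_) (glaisher∘glaisher⁻¹ g≡0 s 1≤s)) ⟩
    weight N g
      ≡⟨ weight≡N ⟩
    N ∎)
    where open ≡-Reasoning

  glaisherBijection : ∀ N → MultsBijection N
  glaisherBijection N = record
    { to = glaisher
    ; from = glaisher⁻¹ N
    ; to-cong = glaisher-cong
    ; from-cong = glaisher⁻¹-cong N
    ; to-valid = glaisher-valid
    ; from-valid = glaisher⁻¹-valid
    ; from∘to = λ valid → glaisher⁻¹∘glaisher (carry-vanishesAbove valid)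
    ; to∘from = λ (g≡0 , _) → glaisher∘glaisher⁻¹ g≡0
    }

theorem5 : (p : ℕ) → 2 ≤ p → (n : ℕ) → 1 ≤ n → (k : ℕ) → A p n k ⤖ B p n k
theorem5 (suc p) (s≤s _) n _ =
  partitionBijection (glaisherBijection n) (numDivSizes (suc p)) (numFreqSizes (suc p)) stat
  where
  instance
    2^[1+p]≢0 : NonZero (2 ^ suc p)
    2^[1+p]≢0 = m^n≢0 2 (suc p)
  open Glaisher (2 ^ suc p) (*-monoʳ-≤ 2 (m^n>0 2 p))
  stat : ∀ {f} → IsPartitionMults n f →
         numFreqSizes (suc p) (fromMult n (glaisher f)) ≡ numDivSizes (suc p) (fromMult n f)
  stat {f} (f≡0 , _) = begin
    numFreqSizes (suc p) (fromMult n (glaisher f))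
      ≡⟨ numFreqSizes-fromMult (suc p) n (glaisher f) ⟩
    sumTo (λ s → when (2 ^ suc p ≤? glaisher f s) (sgn (glaisher f s))) n
      ≡⟨ count-glaisher f≡0 ⟩
    sumTo (λ s → when (2 ^ suc p ∣? s) (sgn (f s))) n
      ≡⟨ numDivSizes-fromMult (suc p) n f ⟨
    numDivSizes (suc p) (fromMult n f) ∎
    where open ≡-Reasoning
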